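{- Let $n\geq 1$ and let $Q_n$ be the para-chain square cactus with $n$ squares. Let $r$ be a vertex of $Q_n$ of maximum eccentricity, i.e. (for $n\geq 2$) a vertex of an end square at distance $2$ from the unique cut-vertex of that square, and (for $n=1$) any vertex. Then $\pi(Q_n,r)=2^{2n}$.
   Context: Let $G=(V,E)$ be a simple connected graph and $r\in V$. A configuration is a function $f:V\to\mathbb{N}\cup\{0\}$, with weight $|f|=\sum_{u\in V}f(u)$. A pebbling step from a vertex $u$ to a neighbor $v$ decreases $f(u)$ by two and increases $f(v)$ by one. A configuration is $r$-solvable if some (possibly empty) sequence of pebbling steps results in at least one pebble on $r$. The rooted pebbling number $\pi(G,r)$ is the minimum $k$ such that every configuration of weight $k$ is $r$-solvable. A square cactus chain is a connected graph all of whose blocks are $4$-cycles, in which every block contains at most two cut-vertices and every cut-vertex is shared by exactly two blocks. An internal square (one with two cut-vertices) is a para-square if its two cut-vertices are non-adjacent. The para-chain square cactus $Q_n$ is the square cactus chain with $n$ squares in which every internal square is a para-square. -}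

module Defs where

open import Data.Nat using (ℕ; zero; suc; _+_; _≤_; _<_; _^_; _*_)
open import Data.Fin using (Fin; inject₁) renaming (suc to fsuc; zero to fzero)
open import Data.List using (List; map; allFin)
open import Data.Nat.ListAction using (sum)
open import Data.Empty using (⊥)
open import Data.Fin using (fromℕ)
open import Data.Product using (Σ; ∃; _×_; _,_)
open import Data.Sum using (_⊎_)
open import Relation.Binary.PropositionalEquality using (_≡_; _≢_)
open import Relation.Binary.Construct.Closure.ReflexiveTransitive using (Star)

-- Square i is the 4-cycle  c i — a i — c (i+1) — b i — c i,
-- so the cut-vertices c i, c (i+1) of an internal square are non-adjacent
-- (para-squares).  c 1, …, c (n-1) are the cut-vertices; c 0 and c n are the
-- vertices of the end squares at distance 2 from their cut-vertex.
data V (n : ℕ) : Set where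
  c : Fin (suc n) → V n
  a : Fin n → V n
  b : Fin n → V n

data Edge {n : ℕ} : V n → V n → Set where
  ca : (i : Fin n) → Edge (c (inject₁ i)) (a i)
  ac : (i : Fin n) → Edge (a i) (c (fsuc i))
  cb : (i : Fin n) → Edge (c (inject₁ i)) (b i)
  bc : (i : Fin n) → Edge (b i) (c (fsuc i))

Adj : {n : ℕ} → V n → V n → Set
Adj u v = Edge u v ⊎ Edge v u

Config : ℕ → Set
Config n = V n → ℕ

weight : {n : ℕ} → Config n → ℕ
weight {n} f = sum (map (λ i → f (c i)) (allFin (suc n)))
             + sum (map (λ i → f (a i)) (allFin n))
             + sum (map (λ i → f (b i)) (allFin n))

data Step {n : ℕ} (f g : Config n) : Set where
  step : (u v : V n) → Adj u v →
         g u + 2 ≡ f u →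
         g v ≡ f v + 1 →
         (∀ w → w ≢ u → w ≢ v → g w ≡ f w) →
         Step f g

Solvable : {n : ℕ} → V n → Config n → Set
Solvable r f = Σ (Config _) λ g → Star Step f g × 1 ≤ g r

PebblingNumberIs : (n : ℕ) → V n → ℕ → Set
PebblingNumberIs n r k =
  (∀ (f : Config n) → weight f ≡ k → Solvable r f)
  × (∀ j → j < k → Σ (Config n) λ f → weight f ≡ j × (Solvable r f → ⊥))

MaxEcc : (n : ℕ) → V n → Set
MaxEcc n r = (n ≡ 1) ⊎ (r ≡ c fzero ⊎ r ≡ c (fromℕ n))

-- In a 4-cycle r – x – z – y – r, any 4t pebbles on the cycle can put t pebbles
-- on r, since one pebble on r never costs more than four: one on r, two on x (or y), two on z
-- and one on x (or y), or four on z.  In the chain of squares starting at c 0, the pebbles beyond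
-- the first square bring to its far corner, at a cost of 4^(n-1) each (by induction), what its
-- three other vertices lack; so 4^n t pebbles put t pebbles on c 0.
--
-- Weight a pebble on w by 2^(e w), where e w is the distance from c n.  Along an
-- edge e rises by at most one, so no step increases the total weight; j < 4^n pebbles on c n
-- have weight j, while one pebble on c 0 alone weighs 4^n.
--
-- The other roots follow by symmetry: the reflection i ↦ n − i of the chain and, for n = 1, the
-- reflection of the 4-cycle exchanging c 0 with a 0 and c 1 with b 0.
module Submission where

open import Defs
open import Data.Nat using (ℕ; zero; suc; _+_; _∸_; _*_; _^_; _≤_; _<_; z≤n; s≤s⁻¹; _≤?_; _<?_)
open import Data.Nat.Properties
open import Data.Nat.ListAction using (sum)
open import Data.Fin using (Fin; inject₁; toℕ; fromℕ; opposite; punchIn) renaming (suc to fsuc; zero to fzero)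
open import Data.Fin.Properties using (toℕ-fromℕ; toℕ-inject₁; opposite-involutive; punchInᵢ≢i) renaming (_≟_ to _≟ᶠ_)
open import Data.Fin.Permutation using (reverse)
open import Data.List using (tabulate; map; allFin)
open import Data.List.Properties using (map-tabulate)
open import Data.Product using (Σ; _×_; _,_)
open import Data.Sum using (inj₁; inj₂; swap)
open import Function using (_∘_; id)
open import Relation.Nullary using (¬_; yes; no; contradiction)
open import Relation.Nullary.Decidable using (map′)
open import Relation.Binary.Definitions using (DecidableEquality)
open import Relation.Binary.PropositionalEquality
open import Relation.Binary.Construct.Closure.ReflexiveTransitive using (Star; ε; _◅_; _◅◅_; gmap)
open import Algebra.Properties.CommutativeMonoid.Sum +-0-commutativeMonoid
  using (sum-syntax; sum-cong-≗; ∑-distrib-+; ∑-permute; sum-remove; sum-replicate-zero)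
  renaming (sum to ∑)
open import Algebra.Properties.CommutativeSemigroup +-commutativeSemigroup using (interchange; xy∙z≈xz∙y)
open import Data.Nat.Tactic.RingSolver using (solve-∀)

sum-allFin : ∀ k (h : Fin k → ℕ) → sum (map h (allFin k)) ≡ ∑[ i < k ] h i
sum-allFin k h = trans (cong sum (map-tabulate id h)) (sum-tabulate k h)
  where
  sum-tabulate : ∀ k (h : Fin k → ℕ) → sum (tabulate h) ≡ ∑[ i < k ] h i
  sum-tabulate zero    h = refl
  sum-tabulate (suc k) h = cong (h fzero +_) (sum-tabulate k (h ∘ fsuc))

∑-zero : ∀ {k} (h : Fin k → ℕ) → (∀ i → h i ≡ 0) → ∑[ i < k ] h i ≡ 0
∑-zero {k} h h≗0 = trans (sum-cong-≗ h≗0) (sum-replicate-zero k)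

∑-single : ∀ {k} (h : Fin k → ℕ) i → (∀ j → j ≢ i → h j ≡ 0) → ∑[ j < k ] h j ≡ h i
∑-single {suc k} h i h≗0 = begin
  ∑[ j < suc k ] h j                  ≡⟨ sum-remove {i = i} h ⟩
  h i + ∑[ j < k ] h (punchIn i j)     ≡⟨ cong (h i +_) (∑-zero _ (λ j → h≗0 _ (punchInᵢ≢i i j))) ⟩
  h i + 0                             ≡⟨ +-identityʳ (h i) ⟩
  h i                                 ∎
  where open ≡-Reasoning

∑-opposite : ∀ {k} (h : Fin k → ℕ) → ∑[ i < k ] h (opposite i) ≡ ∑[ i < k ] h i
∑-opposite h = sym (∑-permute h reverse)

module _ {n : ℕ} where

  _≟ⱽ_ : DecidableEquality (V n)
  c i ≟ⱽ c j = map′ (cong c) (λ { refl → refl }) (i ≟ᶠ j)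
  a i ≟ⱽ a j = map′ (cong a) (λ { refl → refl }) (i ≟ᶠ j)
  b i ≟ⱽ b j = map′ (cong b) (λ { refl → refl }) (i ≟ᶠ j)
  c _ ≟ⱽ a _ = no λ ()
  c _ ≟ⱽ b _ = no λ ()
  a _ ≟ⱽ c _ = no λ ()
  a _ ≟ⱽ b _ = no λ ()
  b _ ≟ⱽ c _ = no λ ()
  b _ ≟ⱽ a _ = no λ ()

  adj⇒≢ : ∀ {u v : V n} → Adj u v → u ≢ v
  adj⇒≢ (inj₁ (ca _)) ()
  adj⇒≢ (inj₁ (ac _)) ()
  adj⇒≢ (inj₁ (cb _)) ()
  adj⇒≢ (inj₁ (bc _)) ()
  adj⇒≢ (inj₂ (ca _)) ()
  adj⇒≢ (inj₂ (ac _)) ()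
  adj⇒≢ (inj₂ (cb _)) ()
  adj⇒≢ (inj₂ (bc _)) ()

  pt : V n → ℕ → Config n
  pt u k w with w ≟ⱽ u
  ... | yes _ = k
  ... | no  _ = 0

  pt-≡ : ∀ u k → pt u k u ≡ k
  pt-≡ u k with u ≟ⱽ u
  ... | yes _   = refl
  ... | no  u≢u = contradiction refl u≢u

  pt-≢ : ∀ {u w} k → w ≢ u → pt u k w ≡ 0
  pt-≢ {u} {w} k w≢u with w ≟ⱽ u
  ... | yes w≡u = contradiction w≡u w≢u
  ... | no  _   = refl

  infixl 6 _⊕_ _⊖_
  infix 4 _≤̇_

  _⊕_ _⊖_ : Config n → Config n → Config n
  (f ⊕ g) w = f w + g w
  (f ⊖ g) w = f w ∸ g w

  _≤̇_ : Config n → Config n → Set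
  f ≤̇ g = ∀ w → f w ≤ g w

  ⊕-⊖-split : ∀ {h f} → h ≤̇ f → h ⊕ (f ⊖ h) ≗ f
  ⊕-⊖-split h≤f w = m+[n∸m]≡n (h≤f w)

  pt-≤̇ : ∀ {u k f} → k ≤ f u → pt u k ≤̇ f
  pt-≤̇ {u} {k} k≤fu w with w ≟ⱽ u
  ... | yes refl = k≤fu
  ... | no  _    = z≤n

  pt⊕pt-≤̇ : ∀ {u v k l f} → u ≢ v → k ≤ f u → l ≤ f v → pt u k ⊕ pt v l ≤̇ f
  pt⊕pt-≤̇ {u} {v} {k} {l} u≢v k≤fu l≤fv w with w ≟ⱽ u
  ... | yes refl = ≤-trans (≤-reflexive (trans (cong (k +_) (pt-≢ l u≢v)) (+-identityʳ k))) k≤fu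
  ... | no  _    = pt-≤̇ l≤fv w

  ∑ᶜ ∑ᵃ ∑ᵇ : Config n → ℕ
  ∑ᶜ f = ∑[ i < suc n ] f (c i)
  ∑ᵃ f = ∑[ i < n ] f (a i)
  ∑ᵇ f = ∑[ i < n ] f (b i)

  weight-∑ : ∀ f → weight f ≡ ∑ᶜ f + ∑ᵃ f + ∑ᵇ f
  weight-∑ f = cong₂ _+_ (cong₂ _+_ (sum-allFin _ (f ∘ c)) (sum-allFin _ (f ∘ a))) (sum-allFin _ (f ∘ b))

  weight-≡ : ∀ {f g} → ∑ᶜ f ≡ ∑ᶜ g → ∑ᵃ f ≡ ∑ᵃ g → ∑ᵇ f ≡ ∑ᵇ g → weight f ≡ weight g
  weight-≡ {f} {g} ∑ᶜ≡ ∑ᵃ≡ ∑ᵇ≡ = trans (weight-∑ f) (trans (cong₂ _+_ (cong₂ _+_ ∑ᶜ≡ ∑ᵃ≡) ∑ᵇ≡) (sym (weight-∑ g)))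

  weight-cong : ∀ {f g} → f ≗ g → weight f ≡ weight g
  weight-cong {f} {g} f≗g =
    weight-≡ {f = f} {g} (sum-cong-≗ (f≗g ∘ c)) (sum-cong-≗ (f≗g ∘ a)) (sum-cong-≗ (f≗g ∘ b))

  weight-⊕ : ∀ f g → weight (f ⊕ g) ≡ weight f + weight g
  weight-⊕ f g = begin
    weight (f ⊕ g)                                ≡⟨ weight-∑ (f ⊕ g) ⟩
    ∑ᶜ (f ⊕ g) + ∑ᵃ (f ⊕ g) + ∑ᵇ (f ⊕ g)          ≡⟨ cong₂ _+_ (cong₂ _+_ ∑ᶜ-⊕ ∑ᵃ-⊕) ∑ᵇ-⊕ ⟩
    (∑ᶜ f + ∑ᶜ g) + (∑ᵃ f + ∑ᵃ g) + (∑ᵇ f + ∑ᵇ g) ≡⟨ cong (_+ (∑ᵇ f + ∑ᵇ g)) (interchange (∑ᶜ f) _ _ _) ⟩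
    (∑ᶜ f + ∑ᵃ f) + (∑ᶜ g + ∑ᵃ g) + (∑ᵇ f + ∑ᵇ g) ≡⟨ interchange (∑ᶜ f + ∑ᵃ f) _ _ _ ⟩
    (∑ᶜ f + ∑ᵃ f + ∑ᵇ f) + (∑ᶜ g + ∑ᵃ g + ∑ᵇ g)   ≡⟨ cong₂ _+_ (weight-∑ f) (weight-∑ g) ⟨
    weight f + weight g                           ∎
    where
    open ≡-Reasoning
    ∑ᶜ-⊕ = ∑-distrib-+ (f ∘ c) (g ∘ c)
    ∑ᵃ-⊕ = ∑-distrib-+ (f ∘ a) (g ∘ a)
    ∑ᵇ-⊕ = ∑-distrib-+ (f ∘ b) (g ∘ b)

  weight-pt : ∀ u k → weight (pt u k) ≡ k
  weight-pt u k = trans (weight-∑ (pt u k)) (sums u)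
    where
    single : ∀ {m} (v : Fin m → V n) → (∀ {i j} → v i ≡ v j → i ≡ j) → ∀ i →
             ∑[ j < m ] pt (v i) k (v j) ≡ k
    single v v-injective i =
      trans (∑-single _ i (λ j j≢i → pt-≢ k (j≢i ∘ v-injective))) (pt-≡ (v i) k)
    empty : ∀ {m} u (v : Fin m → V n) → (∀ j → v j ≢ u) → ∑[ j < m ] pt u k (v j) ≡ 0
    empty u v v≢u = ∑-zero _ (λ j → pt-≢ k (v≢u j))
    sums : ∀ u → ∑ᶜ (pt u k) + ∑ᵃ (pt u k) + ∑ᵇ (pt u k) ≡ k
    sums (c i) = begin
      _         ≡⟨ cong₂ _+_ (cong₂ _+_ (single c (λ { refl → refl }) i) (empty (c i) a λ _ ()))
                             (empty (c i) b λ _ ()) ⟩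
      k + 0 + 0 ≡⟨ cong (_+ 0) (+-identityʳ k) ⟩
      k + 0     ≡⟨ +-identityʳ k ⟩
      k         ∎
      where open ≡-Reasoning
    sums (a i) = begin
      _         ≡⟨ cong₂ _+_ (cong₂ _+_ (empty (a i) c λ _ ()) (single a (λ { refl → refl }) i))
                             (empty (a i) b λ _ ()) ⟩
      k + 0     ≡⟨ +-identityʳ k ⟩
      k         ∎
      where open ≡-Reasoning
    sums (b i) =
      cong₂ _+_ (cong₂ _+_ (empty (b i) c λ _ ()) (empty (b i) a λ _ ())) (single b (λ { refl → refl }) i)

  ≤-weight : ∀ f u → f u ≤ weight f
  ≤-weight f u = begin
    f u                      ≡⟨ weight-pt u (f u) ⟨
    weight h                 ≤⟨ m≤m+n (weight h) (weight (f ⊖ h)) ⟩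
    weight h + weight (f ⊖ h) ≡⟨ weight-⊕ h (f ⊖ h) ⟨
    weight (h ⊕ (f ⊖ h))     ≡⟨ weight-cong (⊕-⊖-split {h} {f} (pt-≤̇ {u} ≤-refl)) ⟩
    weight f                 ∎
    where
    open ≤-Reasoning
    h = pt u (f u)

  -- Solvable r is Reach r 1, definitionally.
  Reach : V n → ℕ → Config n → Set
  Reach r t f = Σ (Config n) λ g → Star Step f g × t ≤ g r

  reach-here : ∀ {r t f} → t ≤ f r → Reach r t f
  reach-here {f = f} t≤fr = f , ε , t≤fr

  reach-◅◅ : ∀ {r t f g} → Star Step f g → Reach r t g → Reach r t f
  reach-◅◅ f⇝g (h , g⇝h , t≤hr) = h , f⇝g ◅◅ g⇝h , t≤hr

  reach-≗ : ∀ {r t f f′} → f ≗ f′ → Reach r t f → Reach r t f′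
  reach-≗ {f′ = f′} f≗f′ (_ , ε , t≤fr) = f′ , ε , ≤-trans t≤fr (≤-reflexive (f≗f′ _))
  reach-≗ f≗f′ (h , step u v u~v gu fv rest ◅ g⇝h , t≤hr) = h , step′ ◅ g⇝h , t≤hr
    where
    step′ = step u v u~v (trans gu (f≗f′ u)) (trans fv (cong (_+ 1) (f≗f′ v)))
                 (λ w w≢u w≢v → trans (rest w w≢u w≢v) (f≗f′ w))

  step-⊕ˡ : ∀ h {f g} → Step f g → Step (h ⊕ f) (h ⊕ g)
  step-⊕ˡ h (step u v u~v gu fv rest) =
    step u v u~v (trans (+-assoc (h u) _ 2) (cong (h u +_) gu))
                 (trans (cong (h v +_) fv) (sym (+-assoc (h v) _ 1)))
                 (λ w w≢u w≢v → cong (h w +_) (rest w w≢u w≢v))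

  step-⊕ʳ : ∀ h {f g} → Step f g → Step (f ⊕ h) (g ⊕ h)
  step-⊕ʳ h (step u v u~v gu fv rest) =
    step u v u~v (trans (xy∙z≈xz∙y _ (h u) 2) (cong (_+ h u) gu))
                 (trans (cong (_+ h v) fv) (xy∙z≈xz∙y _ 1 (h v)))
                 (λ w w≢u w≢v → cong (_+ h w) (rest w w≢u w≢v))

  reach-⊕ : ∀ {r s t f g} → Reach r s f → Reach r t g → Reach r (s + t) (f ⊕ g)
  reach-⊕ {g = g} (f′ , f⇝f′ , s≤) (g′ , g⇝g′ , t≤) =
    f′ ⊕ g′ , gmap (_⊕ g) (step-⊕ʳ g) f⇝f′ ◅◅ gmap (f′ ⊕_) (step-⊕ˡ f′) g⇝g′ ,
    +-mono-≤ s≤ t≤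

  pebbleStep : V n → V n → Config n → Config n
  pebbleStep u v f w with w ≟ⱽ u | w ≟ⱽ v
  ... | yes _ | _     = f w ∸ 2
  ... | no  _ | yes _ = f w + 1
  ... | no  _ | no  _ = f w

  pebbleStep-source : ∀ u v f → pebbleStep u v f u ≡ f u ∸ 2
  pebbleStep-source u v f with u ≟ⱽ u
  ... | yes _   = refl
  ... | no  u≢u = contradiction refl u≢u

  pebbleStep-target : ∀ {u v} f → u ≢ v → pebbleStep u v f v ≡ f v + 1
  pebbleStep-target {u} {v} f u≢v with v ≟ⱽ u | v ≟ⱽ v
  ... | yes v≡u | _       = contradiction (sym v≡u) u≢v
  ... | no  _   | yes _   = refl
  ... | no  _   | no  v≢v = contradiction refl v≢v

  pebbleStep-other : ∀ {u v w} f → w ≢ u → w ≢ v → pebbleStep u v f w ≡ f w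
  pebbleStep-other {u} {v} {w} f w≢u w≢v with w ≟ⱽ u | w ≟ⱽ v
  ... | yes w≡u | _       = contradiction w≡u w≢u
  ... | no  _   | yes w≡v = contradiction w≡v w≢v
  ... | no  _   | no  _   = refl

  reach-pebbleStep : ∀ {u v r t f} → Adj u v → 2 ≤ f u → Reach r t (pebbleStep u v f) → Reach r t f
  reach-pebbleStep {u} {v} {f = f} u~v 2≤fu = reach-◅◅ (step′ ◅ ε)
    where
    step′ = step u v u~v (trans (cong (_+ 2) (pebbleStep-source u v f)) (m∸n+n≡m 2≤fu))
                 (pebbleStep-target f (adj⇒≢ u~v)) (λ w → pebbleStep-other f)

  pebbleStep-gain : ∀ {u v k} f → u ≢ v → k ≤ f v → suc k ≤ pebbleStep u v f v
  pebbleStep-gain {k = k} f u≢v k≤fv =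
    ≤-trans (≤-reflexive (+-comm 1 k))
            (≤-trans (+-monoˡ-≤ 1 k≤fv) (≤-reflexive (sym (pebbleStep-target f u≢v))))

  reach-adj : ∀ {u r f} → Adj u r → 2 ≤ f u → Reach r 1 f
  reach-adj {f = f} u~r 2≤fu = reach-pebbleStep u~r 2≤fu (reach-here (pebbleStep-gain f (adj⇒≢ u~r) z≤n))

  reach-path : ∀ {u v r f} → Adj u v → Adj v r → 2 ≤ f u → 1 ≤ f v → Reach r 1 f
  reach-path {f = f} u~v v~r 2≤fu 1≤fv =
    reach-pebbleStep u~v 2≤fu (reach-adj v~r (pebbleStep-gain f (adj⇒≢ u~v) 1≤fv))

  reach-path₄ : ∀ {u v r f} → Adj u v → Adj v r → 4 ≤ f u → Reach r 1 f
  reach-path₄ {u} {v} {f = f} u~v v~r 4≤fu =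
    reach-pebbleStep u~v (≤-trans (m≤n+m 2 2) 4≤fu) (reach-path u~v v~r
      (≤-trans (∸-monoˡ-≤ 2 4≤fu) (≤-reflexive (sym (pebbleStep-source u v f))))
      (pebbleStep-gain f (adj⇒≢ u~v) z≤n))

module Square {n} {r x y z : V n} (x~r : Adj x r) (y~r : Adj y r) (z~x : Adj z x) (z~y : Adj z y)
              (x≢y : x ≢ y) (r≢z : r ≢ z) where

  private
    below : ∀ {k m} → ¬ (suc k ≤ m) → m ≤ k
    below = s≤s⁻¹ ∘ ≰⇒>

  S : Config n → ℕ
  S f = f r + f x + f y + f z

  S-cong : ∀ {f g} → f ≗ g → S f ≡ S g
  S-cong {f} {g} f≗g rewrite f≗g r | f≗g x | f≗g y | f≗g z = refl

  S-⊕ : ∀ f g → S (f ⊕ g) ≡ S f + S g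
  S-⊕ f g = regroup (f r) (f x) (f y) (f z) (g r) (g x) (g y) (g z)
    where
    regroup : ∀ p q s u p′ q′ s′ u′ →
              (p + p′) + (q + q′) + (s + s′) + (u + u′) ≡ (p + q + s + u) + (p′ + q′ + s′ + u′)
    regroup = solve-∀

  S-pt-r : ∀ k → S (pt r k) ≡ k
  S-pt-r k rewrite pt-≡ r k | pt-≢ k (adj⇒≢ x~r) | pt-≢ k (adj⇒≢ y~r) | pt-≢ k (r≢z ∘ sym) =
    trans (+-identityʳ _) (trans (+-identityʳ _) (+-identityʳ k))

  S-pt-x : ∀ k → S (pt x k) ≡ k
  S-pt-x k rewrite pt-≡ x k | pt-≢ k (adj⇒≢ x~r ∘ sym) | pt-≢ k (x≢y ∘ sym) | pt-≢ k (adj⇒≢ z~x) =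
    trans (+-identityʳ _) (+-identityʳ k)

  S-pt-y : ∀ k → S (pt y k) ≡ k
  S-pt-y k rewrite pt-≡ y k | pt-≢ k (adj⇒≢ y~r ∘ sym) | pt-≢ k x≢y | pt-≢ k (adj⇒≢ z~y) =
    +-identityʳ k

  S-pt-z : ∀ k → S (pt z k) ≡ k
  S-pt-z k rewrite pt-≡ z k | pt-≢ k r≢z | pt-≢ k (adj⇒≢ z~x ∘ sym) | pt-≢ k (adj⇒≢ z~y ∘ sym) = refl

  S-≤ : ∀ {f p q s u} → f r ≤ p → f x ≤ q → f y ≤ s → f z ≤ u → S f ≤ p + q + s + u
  S-≤ fr≤ fx≤ fy≤ fz≤ = +-mono-≤ (+-mono-≤ (+-mono-≤ fr≤ fx≤) fy≤) fz≤

  S-≥ : ∀ {f p q s u} → p ≤ f r → q ≤ f x → s ≤ f y → u ≤ f z → p + q + s + u ≤ S f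
  S-≥ ≤fr ≤fx ≤fy ≤fz = +-mono-≤ (+-mono-≤ (+-mono-≤ ≤fr ≤fx) ≤fy) ≤fz

  record CheapMove (f : Config n) : Set where
    field
      move  : Config n
      move≤ : move ≤̇ f
      cost  : S move ≤ 4
      reach : Reach r 1 move

  point-move : ∀ {f} u k → S (pt u k) ≡ k → k ≤ 4 → k ≤ f u → Reach r 1 (pt u k) → CheapMove f
  point-move u k S≡k k≤4 k≤fu reach = record
    { move = pt u k ; move≤ = pt-≤̇ k≤fu ; cost = ≤-trans (≤-reflexive S≡k) k≤4 ; reach = reach }

  pair-move : ∀ {f v} → Adj z v → Adj v r → (∀ k → S (pt v k) ≡ k) → 2 ≤ f z → 1 ≤ f v → CheapMove f
  pair-move {v = v} z~v v~r S-pt-v 2≤fz 1≤fv = record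
    { move  = pt z 2 ⊕ pt v 1
    ; move≤ = pt⊕pt-≤̇ (adj⇒≢ z~v) 2≤fz 1≤fv
    ; cost  = ≤-trans (≤-reflexive (trans (S-⊕ (pt z 2) (pt v 1)) (cong₂ _+_ (S-pt-z 2) (S-pt-v 1)))) (n≤1+n 3)
    ; reach = reach-path z~v v~r
        (≤-trans (m≤m+n 2 (pt v 1 z)) (≤-reflexive (cong (_+ pt v 1 z) (sym (pt-≡ z 2)))))
        (≤-trans (m≤n+m 1 (pt z 2 v)) (≤-reflexive (cong (pt z 2 v +_) (sym (pt-≡ v 1)))))
    }

  cheap-move : ∀ f → 4 ≤ S f → CheapMove f
  cheap-move f 4≤S with 1 ≤? f r | 2 ≤? f x | 2 ≤? f y | 4 ≤? f z | 2 ≤? f z | 1 ≤? f x | 1 ≤? f y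
  ... | yes 1≤fr | _ | _ | _ | _ | _ | _ =
    point-move r 1 (S-pt-r 1) (m≤n+m 1 3) 1≤fr (reach-here (≤-reflexive (sym (pt-≡ r 1))))
  ... | no _ | yes 2≤fx | _ | _ | _ | _ | _ =
    point-move x 2 (S-pt-x 2) (m≤n+m 2 2) 2≤fx (reach-adj x~r (≤-reflexive (sym (pt-≡ x 2))))
  ... | no _ | no _ | yes 2≤fy | _ | _ | _ | _ =
    point-move y 2 (S-pt-y 2) (m≤n+m 2 2) 2≤fy (reach-adj y~r (≤-reflexive (sym (pt-≡ y 2))))
  ... | no _ | no _ | no _ | yes 4≤fz | _ | _ | _ =
    point-move z 4 (S-pt-z 4) ≤-refl 4≤fz (reach-path₄ z~x x~r (≤-reflexive (sym (pt-≡ z 4))))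
  ... | no _ | no _ | no _ | no _ | yes 2≤fz | yes 1≤fx | _ = pair-move z~x x~r S-pt-x 2≤fz 1≤fx
  ... | no _ | no _ | no _ | no _ | yes 2≤fz | no _ | yes 1≤fy = pair-move z~y y~r S-pt-y 2≤fz 1≤fy
  ... | no fr<1 | no fx<2 | no fy<2 | no _ | no fz<2 | _ | _ =
    contradiction (≤-trans 4≤S (S-≤ (below fr<1) (below fx<2) (below fy<2) (below fz<2))) 1+n≰n
  ... | no fr<1 | no _ | no _ | no fz<4 | yes _ | no fx<1 | no fy<1 =
    contradiction (≤-trans 4≤S (S-≤ (below fr<1) (below fx<1) (below fy<1) (below fz<4))) 1+n≰n

  square-reach : ∀ t f → 4 * t ≤ S f → Reach r t f
  square-reach zero    f _     = reach-here z≤n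
  square-reach (suc t) f 4t+4≤S =
    reach-≗ (⊕-⊖-split move≤) (reach-⊕ reach (square-reach t (f ⊖ move) enough))
    where
    open ≤-Reasoning
    4+4t≤S : 4 + 4 * t ≤ S f
    4+4t≤S = ≤-trans (≤-reflexive (sym (*-suc 4 t))) 4t+4≤S
    open CheapMove (cheap-move f (≤-trans (m≤m+n 4 (4 * t)) 4+4t≤S))
    enough : 4 * t ≤ S (f ⊖ move)
    enough = +-cancelˡ-≤ 4 _ _ (begin
      4 + 4 * t             ≤⟨ 4+4t≤S ⟩
      S f                   ≡⟨ S-cong (⊕-⊖-split move≤) ⟨
      S (move ⊕ (f ⊖ move)) ≡⟨ S-⊕ move (f ⊖ move) ⟩
      S move + S (f ⊖ move) ≤⟨ +-monoˡ-≤ _ cost ⟩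
      4 + S (f ⊖ move)      ∎)

deficit-bound : ∀ m t w R → 4 ^ suc m * t ≤ w + R → 4 ^ m * (4 * t ∸ w) ≤ R
deficit-bound m t w R le = begin
  4 ^ m * (4 * t ∸ w)         ≡⟨ *-distribˡ-∸ (4 ^ m) (4 * t) w ⟩
  4 ^ m * (4 * t) ∸ 4 ^ m * w ≤⟨ ∸-monoʳ-≤ _ w≤4^m*w ⟩
  4 ^ m * (4 * t) ∸ w         ≡⟨ cong (_∸ w) (trans (sym (*-assoc (4 ^ m) 4 t)) (cong (_* t) (*-comm (4 ^ m) 4))) ⟩
  4 ^ suc m * t ∸ w           ≤⟨ ∸-monoˡ-≤ w le ⟩
  w + R ∸ w                   ≡⟨ m+n∸m≡n w R ⟩
  R                           ∎
  where
  open ≤-Reasoning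
  w≤4^m*w : w ≤ 4 ^ m * w
  w≤4^m*w = ≤-trans (≤-reflexive (sym (*-identityˡ w))) (*-monoˡ-≤ w (m^n>0 4 m))

module _ {n : ℕ} where

  squareIndex : V n → ℕ
  squareIndex (c i) = toℕ i
  squareIndex (a i) = toℕ i
  squareIndex (b i) = toℕ i

  beyond : ℕ → Config n → Config n
  beyond o f w with o <? squareIndex w
  ... | yes _ = f w
  ... | no  _ = 0

  beyond-≤̇ : ∀ o f → beyond o f ≤̇ f
  beyond-≤̇ o f w with o <? squareIndex w
  ... | yes _ = ≤-refl
  ... | no  _ = z≤n

  beyond-> : ∀ {o w} f → o < squareIndex w → beyond o f w ≡ f w
  beyond-> {o} {w} f o<i with o <? squareIndex w
  ... | yes _   = refl
  ... | no  o≮i = contradiction o<i o≮i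

  beyond-≤ : ∀ {o w} f → squareIndex w ≤ o → beyond o f w ≡ 0
  beyond-≤ {o} {w} f i≤o with o <? squareIndex w
  ... | yes o<i = contradiction o<i (≤⇒≯ i≤o)
  ... | no  _   = refl

  -- Squares offset, …, offset + m − 1 of Q n; square j is the cycle v j – x j – v (j+1) – y j,
  -- and c i counts as a vertex of square i.
  record SquareChain (m : ℕ) : Set where
    field
      offset : ℕ
      v      : Fin (suc m) → V n
      x y    : Fin m → V n
      x~v    : ∀ j → Adj (x j) (v (inject₁ j))
      y~v    : ∀ j → Adj (y j) (v (inject₁ j))
      v~x    : ∀ j → Adj (v (fsuc j)) (x j)
      v~y    : ∀ j → Adj (v (fsuc j)) (y j)
      x≢y    : ∀ j → x j ≢ y j
      index-v : ∀ j → squareIndex (v j) ≡ offset + toℕ j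
      index-x : ∀ j → squareIndex (x j) ≡ offset + toℕ j
      index-y : ∀ j → squareIndex (y j) ≡ offset + toℕ j

    weightOn : Config n → ℕ
    weightOn f = f (v fzero) + ∑[ j < m ] (f (x j) + f (y j) + f (v (fsuc j)))

    weightOn-beyond : ∀ {o} f → o < offset → weightOn (beyond o f) ≡ weightOn f
    weightOn-beyond {o} f o<offset =
      cong₂ _+_ (far v index-v fzero)
        (sum-cong-≗ λ j → cong₂ _+_ (cong₂ _+_ (far x index-x j) (far y index-y j)) (far v index-v (fsuc j)))
      where
      far : ∀ {k} (u : Fin k → V n) → (∀ j → squareIndex (u j) ≡ offset + toℕ j) →
            ∀ j → beyond o f (u j) ≡ f (u j)
      far u index j = beyond-> f (≤-trans o<offset (≤-trans (m≤m+n offset (toℕ j)) (≤-reflexive (sym (index j)))))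

  tail : ∀ {m} → SquareChain (suc m) → SquareChain m
  tail C = record
    { offset = suc offset
    ; v = v ∘ fsuc ; x = x ∘ fsuc ; y = y ∘ fsuc
    ; x~v = x~v ∘ fsuc ; y~v = y~v ∘ fsuc ; v~x = v~x ∘ fsuc ; v~y = v~y ∘ fsuc
    ; x≢y = x≢y ∘ fsuc
    ; index-v = λ j → trans (index-v (fsuc j)) (+-suc offset (toℕ j))
    ; index-x = λ j → trans (index-x (fsuc j)) (+-suc offset (toℕ j))
    ; index-y = λ j → trans (index-y (fsuc j)) (+-suc offset (toℕ j))
    }
    where open SquareChain C

  module _ {m} (C : SquareChain (suc m)) where
    open SquareChain C

    weightOn-tail : ∀ f → weightOn f ≡ f (v fzero) + f (x fzero) + f (y fzero) + SquareChain.weightOn (tail C) f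
    weightOn-tail f = regroup (f (v fzero)) (f (x fzero)) (f (y fzero)) (f (v (fsuc fzero))) _
      where
      regroup : ∀ p q s u R → p + (q + s + u + R) ≡ p + q + s + (u + R)
      regroup = solve-∀

    -- The far squares bring k pebbles to v 1 using only the pebbles beyond the first square;
    -- the pebbles kept aside on v 0, x 0 and y 0 then join them in the first square.
    reach-across-head : ∀ t k f → 4 * t ≤ f (v fzero) + f (x fzero) + f (y fzero) + k →
                        Reach (v (fsuc fzero)) k (beyond offset f) → Reach (v fzero) t f
    reach-across-head t k f 4t≤ (g , far⇝g , k≤g) =
      reach-≗ (⊕-⊖-split (beyond-≤̇ offset f))
        (reach-◅◅ (gmap (_⊕ near) (step-⊕ʳ near) far⇝g) (square-reach t (g ⊕ near) enough))
      where
      v₀≢v₁ : v fzero ≢ v (fsuc fzero)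
      v₀≢v₁ eq = 0≢1+n (+-cancelˡ-≡ offset 0 1
        (trans (sym (index-v fzero)) (trans (cong squareIndex eq) (index-v (fsuc fzero)))))
      open Square (x~v fzero) (y~v fzero) (v~x fzero) (v~y fzero) (x≢y fzero) v₀≢v₁
      near : Config n
      near = f ⊖ beyond offset f
      kept : ∀ {u} → squareIndex u ≡ offset + 0 → f u ≤ (g ⊕ near) u
      kept {u} index-u =
        ≤-trans (≤-reflexive (cong (f u ∸_) (sym (beyond-≤ {w = u} f i≤o)))) (m≤n+m (near u) (g u))
        where i≤o = ≤-reflexive (trans index-u (+-identityʳ offset))
      enough : 4 * t ≤ S (g ⊕ near)
      enough = ≤-trans 4t≤ (S-≥ {g ⊕ near} (kept (index-v fzero)) (kept (index-x fzero)) (kept (index-y fzero))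
                                             (≤-trans k≤g (m≤m+n _ (near (v (fsuc fzero))))))

  chain-reach : ∀ {m} (C : SquareChain m) t f → 4 ^ m * t ≤ SquareChain.weightOn C f →
                Reach (SquareChain.v C fzero) t f
  chain-reach {zero}  C t f le = reach-here (subst₂ _≤_ (*-identityˡ t) (+-identityʳ _) le)
  chain-reach {suc m} C t f le =
    reach-across-head C t (4 * t ∸ w₀) f (m≤n+m∸n (4 * t) w₀)
      (chain-reach (tail C) (4 * t ∸ w₀) (beyond offset f)
        (≤-trans (deficit-bound m t w₀ _ (≤-trans le (≤-reflexive (weightOn-tail C f))))
                 (≤-reflexive (sym (SquareChain.weightOn-beyond (tail C) f (n<1+n offset))))))
    where
    open SquareChain C
    w₀ = f (v fzero) + f (x fzero) + f (y fzero)

module Potential {n} (e : V n → ℕ) (e-adj : ∀ {u v} → Adj u v → e v ≤ suc (e u)) where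

  scaled : Config n → Config n
  scaled f w = f w * 2 ^ e w

  Φ : Config n → ℕ
  Φ f = weight (scaled f)

  Φ-⊕ : ∀ f g → Φ (f ⊕ g) ≡ Φ f + Φ g
  Φ-⊕ f g = trans (weight-cong (λ w → *-distribʳ-+ (2 ^ e w) (f w) (g w))) (weight-⊕ (scaled f) (scaled g))

  Φ-pt : ∀ u k → Φ (pt u k) ≡ k * 2 ^ e u
  Φ-pt u k = trans (weight-cong scaled-pt) (weight-pt u (k * 2 ^ e u))
    where
    scaled-pt : scaled (pt u k) ≗ pt u (k * 2 ^ e u)
    scaled-pt w with w ≟ⱽ u
    ... | yes refl = refl
    ... | no  _    = refl

  step-balance : ∀ {f g : Config n} {u v} → Adj u v → g u + 2 ≡ f u → g v ≡ f v + 1 →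
                 (∀ w → w ≢ u → w ≢ v → g w ≡ f w) → g ⊕ pt u 2 ≗ f ⊕ pt v 1
  step-balance {f} {g} {u} {v} u~v gu fv rest w with w ≟ⱽ u | w ≟ⱽ v
  ... | yes refl | yes u≡v = contradiction u≡v (adj⇒≢ u~v)
  ... | yes refl | no  _   = trans gu (sym (+-identityʳ (f u)))
  ... | no  _    | yes refl = trans (+-identityʳ (g v)) fv
  ... | no  w≢u  | no  w≢v  = cong (_+ 0) (rest w w≢u w≢v)

  Φ-step : ∀ {f g} → Step f g → Φ g ≤ Φ f
  Φ-step {f} {g} (step u v u~v gu fv rest) = +-cancelʳ-≤ (2 ^ suc (e u)) (Φ g) (Φ f) (begin
    Φ g + 2 * 2 ^ e u   ≡⟨ cong (Φ g +_) (Φ-pt u 2) ⟨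
    Φ g + Φ (pt u 2)    ≡⟨ Φ-⊕ g (pt u 2) ⟨
    Φ (g ⊕ pt u 2)      ≡⟨ weight-cong {f = scaled (g ⊕ pt u 2)} (λ w → cong (_* 2 ^ e w) (balance w)) ⟩
    Φ (f ⊕ pt v 1)      ≡⟨ Φ-⊕ f (pt v 1) ⟩
    Φ f + Φ (pt v 1)    ≡⟨ cong (Φ f +_) (Φ-pt v 1) ⟩
    Φ f + 1 * 2 ^ e v   ≤⟨ +-monoʳ-≤ (Φ f) (≤-trans (≤-reflexive (*-identityˡ _)) (^-monoʳ-≤ 2 (e-adj u~v))) ⟩
    Φ f + 2 ^ suc (e u) ∎)
    where
    open ≤-Reasoning
    balance = step-balance {f} {g} u~v gu fv rest

  Φ-star : ∀ {f g} → Star Step f g → Φ g ≤ Φ f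
  Φ-star ε            = ≤-refl
  Φ-star (s ◅ f⇝g) = ≤-trans (Φ-star f⇝g) (Φ-step s)

  solvable⇒2^e≤Φ : ∀ {r f} → Solvable r f → 2 ^ e r ≤ Φ f
  solvable⇒2^e≤Φ {r} {f} (g , f⇝g , 1≤gr) = begin
    2 ^ e r       ≡⟨ *-identityˡ _ ⟨
    1 * 2 ^ e r   ≤⟨ *-monoˡ-≤ _ 1≤gr ⟩
    g r * 2 ^ e r ≤⟨ ≤-weight (scaled g) r ⟩
    Φ g           ≤⟨ Φ-star f⇝g ⟩
    Φ f           ∎
    where open ≤-Reasoning

  pt-unsolvable : ∀ {r z j} → e z ≡ 0 → j < 2 ^ e r → ¬ Solvable r (pt z j)
  pt-unsolvable {r} {z} {j} ez≡0 j<2^er solvable = <⇒≱ j<2^er (begin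
    2 ^ e r      ≤⟨ solvable⇒2^e≤Φ solvable ⟩
    Φ (pt z j)   ≡⟨ Φ-pt z j ⟩
    j * 2 ^ e z  ≡⟨ cong (λ d → j * 2 ^ d) ez≡0 ⟩
    j * 1        ≡⟨ *-identityʳ j ⟩
    j            ∎)
    where open ≤-Reasoning

module Symmetry {n} (φ : V n → V n) (φ-involutive : ∀ w → φ (φ w) ≡ w)
                (φ-adj : ∀ {u w} → Adj u w → Adj (φ u) (φ w))
                (weight-∘φ : ∀ f → weight (f ∘ φ) ≡ weight f) where

  step-∘φ : ∀ {f g} → Step f g → Step (f ∘ φ) (g ∘ φ)
  step-∘φ {f} {g} (step u v u~v gu fv rest) =
    step (φ u) (φ v) (φ-adj u~v)
      (subst (λ w → g w + 2 ≡ f w) (sym (φ-involutive u)) gu)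
      (subst (λ w → g w ≡ f w + 1) (sym (φ-involutive v)) fv)
      (λ w w≢φu w≢φv → rest (φ w) (image-≢ w≢φu) (image-≢ w≢φv))
    where
    image-≢ : ∀ {w t} → w ≢ φ t → φ w ≢ t
    image-≢ {w} w≢φt φw≡t = w≢φt (trans (sym (φ-involutive w)) (cong φ φw≡t))

  solvable-∘φ : ∀ {r f} → Solvable r f → Solvable (φ r) (f ∘ φ)
  solvable-∘φ {r} (g , f⇝g , 1≤gr) =
    g ∘ φ , gmap (_∘ φ) step-∘φ f⇝g , subst (λ w → 1 ≤ g w) (sym (φ-involutive r)) 1≤gr

  solvable-∘φ⁻¹ : ∀ {r f} → Solvable (φ r) (f ∘ φ) → Solvable r f
  solvable-∘φ⁻¹ {r} {f} solvable =
    reach-≗ (cong f ∘ φ-involutive)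
            (subst (λ w → Solvable w (f ∘ φ ∘ φ)) (φ-involutive r) (solvable-∘φ solvable))

  pebblingNumberIs-φ : ∀ {r k} → PebblingNumberIs n r k → PebblingNumberIs n (φ r) k
  pebblingNumberIs-φ (upper , lower) =
    (λ f wf → reach-≗ (cong f ∘ φ-involutive) (solvable-∘φ (upper (f ∘ φ) (trans (weight-∘φ f) wf))))
    , λ j j<k → let (f , wf , unsolvable) = lower j j<k in
        f ∘ φ , trans (weight-∘φ f) wf , unsolvable ∘ solvable-∘φ⁻¹

module _ {n : ℕ} where

  reflect : V n → V n
  reflect (c i) = c (opposite i)
  reflect (a i) = a (opposite i)
  reflect (b i) = b (opposite i)

  reflect-involutive : ∀ w → reflect (reflect w) ≡ w
  reflect-involutive (c i) = cong c (opposite-involutive i)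
  reflect-involutive (a i) = cong a (opposite-involutive i)
  reflect-involutive (b i) = cong b (opposite-involutive i)

  opposite-inject₁ : ∀ {k} (i : Fin k) → opposite (inject₁ i) ≡ fsuc (opposite i)
  opposite-inject₁ {suc k} fzero    = refl
  opposite-inject₁ {suc k} (fsuc i) = cong inject₁ (opposite-inject₁ i)

  reflect-edge : ∀ {u w : V n} → Edge u w → Adj (reflect u) (reflect w)
  reflect-edge (ca i) = subst (λ j → Adj (c j) (a (opposite i))) (sym (opposite-inject₁ i)) (inj₂ (ac (opposite i)))
  reflect-edge (ac i) = inj₂ (ca (opposite i))
  reflect-edge (cb i) = subst (λ j → Adj (c j) (b (opposite i))) (sym (opposite-inject₁ i)) (inj₂ (bc (opposite i)))
  reflect-edge (bc i) = inj₂ (cb (opposite i))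

  reflect-adj : ∀ {u w : V n} → Adj u w → Adj (reflect u) (reflect w)
  reflect-adj (inj₁ e) = reflect-edge e
  reflect-adj (inj₂ e) = swap (reflect-edge e)

  weight-∘reflect : ∀ f → weight (f ∘ reflect) ≡ weight f
  weight-∘reflect f =
    weight-≡ {f = f ∘ reflect} {f} (∑-opposite (f ∘ c)) (∑-opposite (f ∘ a)) (∑-opposite (f ∘ b))

  dist₀ : V n → ℕ
  dist₀ (c i) = 2 * toℕ i
  dist₀ (a i) = suc (2 * toℕ i)
  dist₀ (b i) = suc (2 * toℕ i)

  dist₀-edge : ∀ {u w : V n} → Edge u w → dist₀ w ≡ suc (dist₀ u)
  dist₀-edge (ca i) = cong (λ k → suc (2 * k)) (sym (toℕ-inject₁ i))
  dist₀-edge (ac i) = *-suc 2 (toℕ i)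
  dist₀-edge (cb i) = cong (λ k → suc (2 * k)) (sym (toℕ-inject₁ i))
  dist₀-edge (bc i) = *-suc 2 (toℕ i)

  dist₀-adj : ∀ {u w : V n} → Adj u w → dist₀ w ≤ suc (dist₀ u)
  dist₀-adj (inj₁ e) = ≤-reflexive (dist₀-edge e)
  dist₀-adj (inj₂ e) = ≤-trans (n≤1+n _) (≤-trans (≤-reflexive (sym (dist₀-edge e))) (n≤1+n _))

  forwardChain : SquareChain {n} n
  forwardChain = record
    { offset = 0
    ; v = c ; x = a ; y = b
    ; x~v = inj₂ ∘ ca ; y~v = inj₂ ∘ cb ; v~x = inj₂ ∘ ac ; v~y = inj₂ ∘ bc
    ; x≢y = λ _ ()
    ; index-v = λ _ → refl ; index-x = λ _ → refl ; index-y = λ _ → refl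
    }

  weightOn-forwardChain : ∀ f → SquareChain.weightOn forwardChain f ≡ weight f
  weightOn-forwardChain f = begin
    f (c fzero) + ∑[ j < n ] (f (a j) + f (b j) + f (c (fsuc j)))
      ≡⟨ cong (f (c fzero) +_) (trans (∑-distrib-+ (λ j → f (a j) + f (b j)) (f ∘ c ∘ fsuc))
                                      (cong (_+ ∑[ j < n ] f (c (fsuc j))) (∑-distrib-+ (f ∘ a) (f ∘ b)))) ⟩
    f (c fzero) + (∑[ j < n ] f (a j) + ∑[ j < n ] f (b j) + ∑[ j < n ] f (c (fsuc j)))
      ≡⟨ regroup (f (c fzero)) _ _ _ ⟩
    f (c fzero) + ∑[ j < n ] f (c (fsuc j)) + ∑[ j < n ] f (a j) + ∑[ j < n ] f (b j)
      ≡⟨ weight-∑ f ⟨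
    weight f
      ∎
    where
    open ≡-Reasoning
    regroup : ∀ p q s u → p + (q + s + u) ≡ p + u + q + s
    regroup = solve-∀

pebbling-c₀ : ∀ n → PebblingNumberIs n (c fzero) (2 ^ (2 * n))
pebbling-c₀ n = upper , lower
  where
  upper : ∀ f → weight f ≡ 2 ^ (2 * n) → Solvable (c fzero) f
  upper f wf = chain-reach forwardChain 1 f (≤-reflexive (begin
    4 ^ n * 1                            ≡⟨ *-identityʳ (4 ^ n) ⟩
    4 ^ n                                ≡⟨ ^-*-assoc 2 2 n ⟩
    2 ^ (2 * n)                          ≡⟨ wf ⟨
    weight f                             ≡⟨ weightOn-forwardChain f ⟨
    SquareChain.weightOn forwardChain f  ∎))
    where open ≡-Reasoning
  -- dist₀ ∘ reflect is the distance from c n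
  open Potential (dist₀ ∘ reflect) (dist₀-adj ∘ reflect-adj)
  c₀-far : dist₀ (reflect {n} (c fzero)) ≡ 2 * n
  c₀-far = cong (2 *_) (toℕ-fromℕ n)
  cₙ-near : dist₀ (reflect {n} (c (fromℕ n))) ≡ 0
  cₙ-near = cong (λ i → 2 * toℕ i) (opposite-involutive {suc n} fzero)
  lower : ∀ j → j < 2 ^ (2 * n) → Σ (Config n) λ f → weight f ≡ j × ¬ Solvable (c fzero) f
  lower j j<4^n = pt (c (fromℕ n)) j , weight-pt (c (fromℕ n)) j ,
    pt-unsolvable cₙ-near (subst (λ d → j < 2 ^ d) (sym c₀-far) j<4^n)

module Reflection {n} = Symmetry {n} reflect reflect-involutive reflect-adj weight-∘reflect

pebbling-cₙ : ∀ n → PebblingNumberIs n (c (fromℕ n)) (2 ^ (2 * n))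
pebbling-cₙ n = Reflection.pebblingNumberIs-φ (pebbling-c₀ n)

mirror : V 1 → V 1
mirror (c fzero)        = a fzero
mirror (c (fsuc fzero)) = b fzero
mirror (a fzero)        = c fzero
mirror (b fzero)        = c (fsuc fzero)

mirror-involutive : ∀ w → mirror (mirror w) ≡ w
mirror-involutive (c fzero)        = refl
mirror-involutive (c (fsuc fzero)) = refl
mirror-involutive (a fzero)        = refl
mirror-involutive (b fzero)        = refl

mirror-edge : ∀ {u w : V 1} → Edge u w → Adj (mirror u) (mirror w)
mirror-edge (ca fzero) = inj₂ (ca fzero)
mirror-edge (ac fzero) = inj₁ (cb fzero)
mirror-edge (cb fzero) = inj₁ (ac fzero)
mirror-edge (bc fzero) = inj₂ (bc fzero)

mirror-adj : ∀ {u w : V 1} → Adj u w → Adj (mirror u) (mirror w)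
mirror-adj (inj₁ e) = mirror-edge e
mirror-adj (inj₂ e) = swap (mirror-edge e)

weight-∘mirror : ∀ f → weight (f ∘ mirror) ≡ weight f
weight-∘mirror f = regroup (f (c fzero)) (f (c (fsuc fzero))) (f (a fzero)) (f (b fzero))
  where
  -- for n = 1 the weight unfolds to its four terms, each list sum ending in + 0
  regroup : ∀ p q s u → s + (u + 0) + (p + 0) + (q + 0) ≡ p + (q + 0) + (s + 0) + (u + 0)
  regroup = solve-∀

module Mirror = Symmetry mirror mirror-involutive mirror-adj weight-∘mirror

pebbling-Q₁ : ∀ r → PebblingNumberIs 1 r 4
pebbling-Q₁ (c fzero)        = pebbling-c₀ 1
pebbling-Q₁ (c (fsuc fzero)) = pebbling-cₙ 1
pebbling-Q₁ (a fzero)        = Mirror.pebblingNumberIs-φ (pebbling-c₀ 1)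
pebbling-Q₁ (b fzero)        = Mirror.pebblingNumberIs-φ (pebbling-cₙ 1)

mainTheorem4 : (n : ℕ) → 1 ≤ n → (r : V n) → MaxEcc n r →
    PebblingNumberIs n r (2 ^ (2 * n))
mainTheorem4 n _ r (inj₁ refl)        = pebbling-Q₁ r
mainTheorem4 n _ r (inj₂ (inj₁ refl)) = pebbling-c₀ n
mainTheorem4 n _ r (inj₂ (inj₂ refl)) = pebbling-cₙ n
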